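{- Let $n\ge1$ and $0\le k\le n$. There is a bijection $\Phi:\mathrm{RInc}_k(2\times n)\to\mathrm{RInc}_k(2\times n)$ such that for every $T\in\mathrm{RInc}_k(2\times n)$ the second row of $\Phi(T)$ equals the second row of $T$ and \[ \mathrm{maj}(\Phi(T))=\mathrm{amaj}(T)+n-k. \]
   Context: $\mathrm{RInc}_k(2\times n)$ is the set of $2\times n$ arrays $T=(T_{i,j})$ (row 1 on top) of positive integers with strictly increasing rows, weakly increasing columns ($T_{1,j}\le T_{2,j}$), and set of entries exactly $\{1,\ldots,2n-k\}$. For such $T$, $i$ is a descent if $i$ occurs in row 1 and $i+1$ occurs in row 2, and an ascent if $i$ occurs in row 2 and $i+1$ occurs in row 1; $\mathrm{maj}(T)$ (resp. $\mathrm{amaj}(T)$) is the sum of the descents (resp. ascents) of $T$. -}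

module Defs where

open import Data.Nat using (ℕ; zero; suc; _+_; _*_; _∸_; _≤_; _<_; _≡ᵇ_)
open import Data.Bool using (Bool; true; false; if_then_else_; _∧_; _∨_)
open import Data.Fin using (Fin; suc)
open import Data.Vec using (Vec; []; _∷_; lookup)
open import Data.List using (List; upTo; map)
open import Data.Nat.ListAction using (sum)
open import Data.Product using (Σ; _×_; ∃; _,_)
open import Data.Sum using (_⊎_)
open import Function.Bundles using (_⇔_)
open import Relation.Binary.PropositionalEquality using (_≡_)

-- A 2 × n array: (row 1 , row 2), row 1 on top; columns indexed by Fin n.
Array : ℕ → Set
Array n = Vec ℕ n × Vec ℕ n

row₁ : ∀ {n} → Array n → Vec ℕ n
row₁ (r , _) = r

row₂ : ∀ {n} → Array n → Vec ℕ n
row₂ (_ , r) = r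

_∈ᵣ_ : ∀ {n} → ℕ → Vec ℕ n → Set
x ∈ᵣ r = ∃ λ j → lookup r j ≡ x

occurs : ∀ {n} → ℕ → Vec ℕ n → Bool
occurs x [] = false
occurs x (y ∷ ys) = (x ≡ᵇ y) ∨ occurs x ys

record IsRInc (k n : ℕ) (T : Array n) : Set where
  field
    row₁-strict : ∀ (i j : Fin n) → Data.Fin._<_ i j → lookup (row₁ T) i < lookup (row₁ T) j
    row₂-strict : ∀ (i j : Fin n) → Data.Fin._<_ i j → lookup (row₂ T) i < lookup (row₂ T) j
    col-weak    : ∀ (j : Fin n) → lookup (row₁ T) j ≤ lookup (row₂ T) j
    entries     : ∀ (x : ℕ) → ((x ∈ᵣ row₁ T) ⊎ (x ∈ᵣ row₂ T)) ⇔ (1 ≤ x × x ≤ (2 * n) ∸ k)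

RInc : ℕ → ℕ → Set
RInc k n = Σ (Array n) (IsRInc k n)

array : ∀ {k n} → RInc k n → Array n
array (T , _) = T

isDescent : ∀ {n} → Array n → ℕ → Bool
isDescent T i = occurs i (row₁ T) ∧ occurs (suc i) (row₂ T)

isAscent : ∀ {n} → Array n → ℕ → Bool
isAscent T i = occurs i (row₂ T) ∧ occurs (suc i) (row₁ T)

-- upper bound on all entries relevant: entries lie in 1 .. 2n-k, we sum over i ∈ {0,…,2n}
-- (i = 0 and i ≥ 2n-k are never descents/ascents for T ∈ RInc_k, as such i do not occur)
maj : ∀ {n} → Array n → ℕ
maj {n} T = sum (map (λ i → if isDescent T i then i else 0) (upTo (suc (2 * n))))

amaj : ∀ {n} → Array n → ℕ
amaj {n} T = sum (map (λ i → if isAscent T i then i else 0) (upTo (suc (2 * n))))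

-- Φ keeps row 2 and, on every maximal run s, s + 1, …, e of consecutive entries of row 2, shifts
-- membership in row 1 cyclically: afterwards s, …, e lie in row 1 iff s + 1, …, e, s did before.
-- For every x outside row 2 the shift keeps the number of row-1 entries below x; these numbers
-- encode the column condition T₁ⱼ ≤ T₂ⱼ, so Φ(T) is again in RInc_k(2 × n), and the reverse
-- shift inverts Φ. Inside a run the descents of Φ(T) are exactly the ascents of T; besides, each
-- run gains the descent s − 1 and, unless e = N = 2n − k, loses the ascent e. As the runs
-- together contain the n entries of row 2, this gives maj Φ(T) = amaj T + N − n = amaj T + n − k.

module Submission where

open import Defs
open import Data.Nat
  using (ℕ; zero; suc; _+_; _*_; _∸_; _≤_; _<_; _≡ᵇ_; pred; z≤n; s≤s; z<s; s<s; _≟_; _<?_; _≤?_)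
open import Data.Nat.Properties
open import Algebra.Properties.CommutativeSemigroup +-commutativeSemigroup using (interchange)
open import Data.Nat.ListAction using (sum)
open import Data.Nat.ListAction.Properties using (sum-++)
open import Data.Nat.Tactic.RingSolver using (solve-∀)
open import Data.Bool using (Bool; true; false; if_then_else_; _∧_; _∨_)
open import Data.Bool.Properties using (∨-zeroʳ; ∧-zeroʳ; ∧-identityʳ; T-≡)
open import Data.Fin as Fin using (toℕ)
open import Data.Vec using (Vec; []; _∷_; lookup; tabulate)
open import Data.Vec.Properties using (tabulate∘lookup; tabulate-cong)
open import Data.Vec.Relation.Unary.All as All using (All; []; _∷_)
open import Data.Vec.Relation.Unary.All.Properties using (lookup⁺; lookup⁻)
open import Data.Vec.Relation.Unary.AllPairs using (AllPairs; []; _∷_)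
open import Data.List using ([]; _∷_; upTo; map; _++_)
open import Data.List.Properties using (upTo-∷ʳ; map-++)
open import Data.Product using (Σ; _×_; ∃; _,_; proj₁; proj₂)
open import Data.Sum using (_⊎_; inj₁; inj₂)
open import Function using (_∘_)
open import Function.Bundles using (_⇔_; mk⇔; Equivalence)
open import Relation.Nullary using (¬_; does; contradiction; yes; no)
open import Relation.Nullary.Decidable using (dec-true; dec-false)
open import Relation.Binary.Definitions using (tri<; tri≈; tri>)
open import Relation.Binary.PropositionalEquality

≡ᵇ-refl : ∀ m → (m ≡ᵇ m) ≡ true
≡ᵇ-refl zero    = refl
≡ᵇ-refl (suc m) = ≡ᵇ-refl m

≢⇒≡ᵇ-false : ∀ {m n} → ¬ m ≡ n → (m ≡ᵇ n) ≡ false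
≢⇒≡ᵇ-false {m} {n} = dec-false (m ≟ n)

≡true⇒≢false : ∀ {b} → b ≡ true → ¬ b ≡ false
≡true⇒≢false refl ()

sumBelow : (ℕ → ℕ) → ℕ → ℕ
sumBelow f zero    = 0
sumBelow f (suc m) = sumBelow f m + f m

sum-map-upTo : ∀ f m → sum (map f (upTo m)) ≡ sumBelow f m
sum-map-upTo f zero    = refl
sum-map-upTo f (suc m) = begin
  sum (map f (upTo (suc m)))           ≡⟨ cong (sum ∘ map f) (upTo-∷ʳ m) ⟨
  sum (map f (upTo m ++ m ∷ []))       ≡⟨ cong sum (map-++ f (upTo m) (m ∷ [])) ⟩
  sum (map f (upTo m) ++ f m ∷ [])     ≡⟨ sum-++ (map f (upTo m)) (f m ∷ []) ⟩
  sum (map f (upTo m)) + (f m + 0)     ≡⟨ cong₂ _+_ (sum-map-upTo f m) (+-identityʳ (f m)) ⟩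
  sumBelow f m + f m                   ∎
  where open ≡-Reasoning

sumBelow-cong : ∀ {f g} → (∀ i → f i ≡ g i) → ∀ m → sumBelow f m ≡ sumBelow g m
sumBelow-cong f≗g zero    = refl
sumBelow-cong f≗g (suc m) = cong₂ _+_ (sumBelow-cong f≗g m) (f≗g m)

sumBelow-+ : ∀ f g m → sumBelow (λ i → f i + g i) m ≡ sumBelow f m + sumBelow g m
sumBelow-+ f g zero    = refl
sumBelow-+ f g (suc m) = begin
  sumBelow (λ i → f i + g i) m + (f m + g m) ≡⟨ cong (_+ (f m + g m)) (sumBelow-+ f g m) ⟩
  sumBelow f m + sumBelow g m + (f m + g m)  ≡⟨ interchange (sumBelow f m) (sumBelow g m) (f m) (g m) ⟩
  sumBelow f m + f m + (sumBelow g m + g m)  ∎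
  where open ≡-Reasoning

sumBelow-mono : ∀ f {m m′} → m ≤ m′ → sumBelow f m ≤ sumBelow f m′
sumBelow-mono f {m′ = zero}  z≤n = z≤n
sumBelow-mono f {m} {suc m′} m≤1+m′ with m≤n⇒m<n∨m≡n m≤1+m′
... | inj₂ refl       = ≤-refl
... | inj₁ (s≤s m≤m′) = ≤-trans (sumBelow-mono f m≤m′) (m≤m+n _ _)

-- Two potentials on opposite sides act as the single potential q − p without truncated subtraction.
sumBelow-telescope : ∀ (f g p q : ℕ → ℕ) →
  (∀ i → p (suc i) + (q i + f i) ≡ p i + (q (suc i) + g i)) →
  ∀ m → p m + (q 0 + sumBelow f m) ≡ p 0 + (q m + sumBelow g m)
sumBelow-telescope f g p q step zero    = refl
sumBelow-telescope f g p q step (suc m) = +-cancelʳ-≡ (p m + q m) _ _ (begin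
  p (suc m) + (q 0 + (sumBelow f m + f m)) + (p m + q m)
    ≡⟨ regroup (p (suc m)) (q 0) (sumBelow f m) (f m) (p m) (q m) ⟩
  (p m + (q 0 + sumBelow f m)) + (p (suc m) + (q m + f m))
    ≡⟨ cong₂ _+_ (sumBelow-telescope f g p q step m) (step m) ⟩
  (p 0 + (q m + sumBelow g m)) + (p m + (q (suc m) + g m))
    ≡⟨ regroup′ (p 0) (q m) (sumBelow g m) (p m) (q (suc m)) (g m) ⟩
  p 0 + (q (suc m) + (sumBelow g m + g m)) + (p m + q m) ∎)
  where
  open ≡-Reasoning
  regroup : ∀ a b c d e f → a + (b + (c + d)) + (e + f) ≡ (e + (b + c)) + (a + (f + d))
  regroup = solve-∀
  regroup′ : ∀ a b c d e f → (a + (b + c)) + (d + (e + f)) ≡ a + (e + (c + f)) + (d + b)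
  regroup′ = solve-∀

sumBelow-single : ∀ a x m → a < m → sumBelow (λ i → if i ≡ᵇ a then x else 0) m ≡ x
sumBelow-single a x (suc m) (s≤s a≤m) with m≤n⇒m<n∨m≡n a≤m
... | inj₁ a<m rewrite sumBelow-single a x m a<m | ≢⇒≡ᵇ-false (<⇒≢ a<m ∘ sym) = +-identityʳ x
... | inj₂ refl rewrite ≡ᵇ-refl a = cong (_+ x) (vanishes a ≤-refl)
  where
  vanishes : ∀ m → m ≤ a → sumBelow (λ i → if i ≡ᵇ a then x else 0) m ≡ 0
  vanishes zero    _     = refl
  vanishes (suc m) 1+m≤a rewrite ≢⇒≡ᵇ-false (<⇒≢ 1+m≤a) =
    trans (+-identityʳ _) (vanishes m (<⇒≤ 1+m≤a))

bit : Bool → ℕ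
bit b = if b then 1 else 0

bit≤1 : ∀ b → bit b ≤ 1
bit≤1 true  = ≤-refl
bit≤1 false = z≤n

count : (ℕ → Bool) → ℕ → ℕ
count c = sumBelow (bit ∘ c)

-- Strictly increasing rows

Increasing : ∀ {n} → Vec ℕ n → Set
Increasing v = ∀ i j → i Fin.< j → lookup v i < lookup v j

Increasing⇒AllPairs : ∀ {n} (v : Vec ℕ n) → Increasing v → AllPairs _<_ v
Increasing⇒AllPairs []       _   = []
Increasing⇒AllPairs (x ∷ xs) inc =
  lookup⁻ (λ j → inc Fin.zero (Fin.suc j) z<s)
    ∷ Increasing⇒AllPairs xs (λ i j i<j → inc (Fin.suc i) (Fin.suc j) (s<s i<j))

AllPairs⇒Increasing : ∀ {n} {v : Vec ℕ n} → AllPairs _<_ v → Increasing v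
AllPairs⇒Increasing (x<xs ∷ _)  Fin.zero    (Fin.suc j) _         = lookup⁺ x<xs j
AllPairs⇒Increasing (_ ∷ xs<)   (Fin.suc i) (Fin.suc j) (s<s i<j) = AllPairs⇒Increasing xs< i j i<j

occursIn : ∀ {n} → Vec ℕ n → ℕ → Bool
occursIn v x = occurs x v

occurs-lookup : ∀ {n} (v : Vec ℕ n) j → occurs (lookup v j) v ≡ true
occurs-lookup (x ∷ xs) Fin.zero    rewrite ≡ᵇ-refl x = refl
occurs-lookup (x ∷ xs) (Fin.suc j) rewrite occurs-lookup xs j = ∨-zeroʳ _

∈ᵣ⇒occurs : ∀ {n} {x} (v : Vec ℕ n) → x ∈ᵣ v → occurs x v ≡ true
∈ᵣ⇒occurs v (j , refl) = occurs-lookup v j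

occurs⇒∈ᵣ : ∀ {n} x (v : Vec ℕ n) → occurs x v ≡ true → x ∈ᵣ v
occurs⇒∈ᵣ x (y ∷ ys) occ with x ≡ᵇ y in x≡ᵇy
... | true  = Fin.zero , sym (≡ᵇ⇒≡ x y (Equivalence.from T-≡ x≡ᵇy))
... | false with occurs⇒∈ᵣ x ys occ
...   | j , yⱼ≡x = Fin.suc j , yⱼ≡x

below⇒¬occurs : ∀ {n} {x} {v : Vec ℕ n} → All (x <_) v → occurs x v ≡ false
below⇒¬occurs []                                   = refl
below⇒¬occurs (x<y ∷ x<ys) rewrite ≢⇒≡ᵇ-false (<⇒≢ x<y) = below⇒¬occurs x<ys

entriesBelow : ∀ {n} → Vec ℕ n → ℕ → ℕ
entriesBelow []       m = 0
entriesBelow (x ∷ xs) m = bit (does (x <? m)) + entriesBelow xs m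

entriesBelow-suc : ∀ {n} {v : Vec ℕ n} → AllPairs _<_ v → ∀ m →
  entriesBelow v (suc m) ≡ entriesBelow v m + bit (occurs m v)
entriesBelow-suc [] m = refl
entriesBelow-suc {v = x ∷ xs} (x<xs ∷ xs<) m with <-cmp x m
... | tri< x<m x≢m _
  rewrite dec-true (x <? suc m) (m<n⇒m<1+n x<m) | dec-true (x <? m) x<m
        | ≢⇒≡ᵇ-false (x≢m ∘ sym) | entriesBelow-suc xs< m = refl
... | tri≈ _ refl _
  rewrite dec-true (x <? suc x) (n<1+n x) | dec-false (x <? x) (<-irrefl refl) = begin
  suc (E (suc x))                  ≡⟨ cong suc (entriesBelow-suc xs< x) ⟩
  suc (E x + bit (occurs x xs))    ≡⟨ cong (λ b → suc (E x + bit b)) (below⇒¬occurs x<xs) ⟩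
  suc (E x + 0)                    ≡⟨ cong suc (+-identityʳ _) ⟩
  suc (E x)                        ≡⟨ +-comm 1 _ ⟩
  E x + 1                          ≡⟨ cong (λ b → E x + bit (b ∨ occurs x xs)) (≡ᵇ-refl x) ⟨
  E x + bit ((x ≡ᵇ x) ∨ occurs x xs) ∎
  where
  open ≡-Reasoning
  E = entriesBelow xs
... | tri> _ x≢m m<x
  rewrite dec-false (x <? suc m) (<⇒≱ m<x ∘ ≤-pred) | dec-false (x <? m) (<⇒≯ m<x)
        | ≢⇒≡ᵇ-false (x≢m ∘ sym) | entriesBelow-suc xs< m = refl

entriesBelow-≤ : ∀ {n} {m} {v : Vec ℕ n} → All (m ≤_) v → entriesBelow v m ≡ 0
entriesBelow-≤ []                             = refl
entriesBelow-≤ {m = m} (_∷_ {x = x} m≤x m≤xs)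
  rewrite dec-false (x <? m) (≤⇒≯ m≤x) = entriesBelow-≤ m≤xs

count-occursIn : ∀ {n} {v : Vec ℕ n} → AllPairs _<_ v → ∀ m →
  count (occursIn v) m ≡ entriesBelow v m
count-occursIn {v = v} v< zero    = sym (entriesBelow-≤ {v = v} (lookup⁻ (λ _ → z≤n)))
count-occursIn {v = v} v< (suc m) =
  trans (cong (_+ bit (occurs m v)) (count-occursIn v< m)) (sym (entriesBelow-suc v< m))

count-occursIn-lookup : ∀ {n} {v : Vec ℕ n} → AllPairs _<_ v → ∀ j →
  count (occursIn v) (lookup v j) ≡ toℕ j
count-occursIn-lookup v< j = trans (count-occursIn v< _) (entriesBelow-lookup v< j)
  where
  entriesBelow-lookup : ∀ {n} {v : Vec ℕ n} → AllPairs _<_ v → ∀ j →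
    entriesBelow v (lookup v j) ≡ toℕ j
  entriesBelow-lookup {v = x ∷ _} (x<xs ∷ _) Fin.zero
    rewrite dec-false (x <? x) (<-irrefl refl) = entriesBelow-≤ (All.map <⇒≤ x<xs)
  entriesBelow-lookup {v = x ∷ xs} (x<xs ∷ xs<) (Fin.suc j)
    rewrite dec-true (x <? lookup xs j) (lookup⁺ x<xs j) = cong suc (entriesBelow-lookup xs< j)

count-occursIn-suc-lookup : ∀ {n} {v : Vec ℕ n} → AllPairs _<_ v → ∀ j →
  count (occursIn v) (suc (lookup v j)) ≡ suc (toℕ j)
count-occursIn-suc-lookup {v = v} v< j
  rewrite count-occursIn-lookup v< j | occurs-lookup v j = +-comm (toℕ j) 1

count-occursIn-all : ∀ {n} {m} {v : Vec ℕ n} → AllPairs _<_ v → All (_< m) v →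
  count (occursIn v) m ≡ n
count-occursIn-all {m = m} v< v<m = trans (count-occursIn v< m) (entriesBelow-all v<m)
  where
  entriesBelow-all : ∀ {n} {v : Vec ℕ n} → All (_< m) v → entriesBelow v m ≡ n
  entriesBelow-all []                          = refl
  entriesBelow-all (_∷_ {x = x} x<m xs<m) rewrite dec-true (x <? m) x<m = cong suc (entriesBelow-all xs<m)

entriesBelow-antitone : ∀ {n} (v w : Vec ℕ n) → (∀ j → lookup v j ≤ lookup w j) →
  ∀ m → entriesBelow w m ≤ entriesBelow v m
entriesBelow-antitone []       []       _   m = z≤n
entriesBelow-antitone (x ∷ xs) (y ∷ ys) v≤w m =
  +-mono-≤ head≤ (entriesBelow-antitone xs ys (v≤w ∘ Fin.suc) m)
  where
  head≤ : bit (does (y <? m)) ≤ bit (does (x <? m))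
  head≤ with x <? m
  ... | yes x<m rewrite dec-true (x <? m) x<m = bit≤1 _
  ... | no  x≮m rewrite dec-false (x <? m) x≮m
                      | dec-false (y <? m) (x≮m ∘ ≤-<-trans (v≤w Fin.zero)) = z≤n

columnwise⇒balanced : ∀ {n} {v w : Vec ℕ n} → AllPairs _<_ v → AllPairs _<_ w →
  (∀ j → lookup v j ≤ lookup w j) → ∀ m → count (occursIn w) m ≤ count (occursIn v) m
columnwise⇒balanced {v = v} {w} v< w< v≤w m
  rewrite count-occursIn v< m | count-occursIn w< m = entriesBelow-antitone v w v≤w m

balanced⇒columnwise : ∀ {n} {v w : Vec ℕ n} → AllPairs _<_ v → AllPairs _<_ w →
  (∀ m → count (occursIn w) m ≤ count (occursIn v) m) → ∀ j → lookup v j ≤ lookup w j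
balanced⇒columnwise {v = v} {w} v< w< balanced j with lookup v j ≤? lookup w j
... | yes vⱼ≤wⱼ = vⱼ≤wⱼ
... | no  vⱼ≰wⱼ = contradiction (balanced (lookup v j)) (<⇒≱ (begin-strict
  count (occursIn v) (lookup v j)         ≡⟨ count-occursIn-lookup v< j ⟩
  toℕ j                                   <⟨ n<1+n (toℕ j) ⟩
  suc (toℕ j)                             ≡⟨ count-occursIn-suc-lookup w< j ⟨
  count (occursIn w) (suc (lookup w j))   ≤⟨ sumBelow-mono _ (≰⇒> vⱼ≰wⱼ) ⟩
  count (occursIn w) (lookup v j)         ∎))
  where open ≤-Reasoning

count-cong : ∀ {c d} → (∀ x → c x ≡ d x) → ∀ m → count c m ≡ count d m
count-cong c≗d = sumBelow-cong (cong bit ∘ c≗d)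

occursIn-injective : ∀ {n} {v w : Vec ℕ n} → AllPairs _<_ v → AllPairs _<_ w →
  (∀ x → occurs x v ≡ occurs x w) → v ≡ w
occursIn-injective {v = v} {w} v< w< v≗w = begin
  v                  ≡⟨ tabulate∘lookup v ⟨
  tabulate (lookup v) ≡⟨ tabulate-cong (λ j → ≤-antisym (v≤w j) (w≤v j)) ⟩
  tabulate (lookup w) ≡⟨ tabulate∘lookup w ⟩
  w                  ∎
  where
  open ≡-Reasoning
  v≤w = balanced⇒columnwise v< w< (≤-reflexive ∘ count-cong (sym ∘ v≗w))
  w≤v = balanced⇒columnwise w< v< (≤-reflexive ∘ count-cong v≗w)

countFrom : (ℕ → Bool) → ℕ → ℕ → ℕ
countFrom c lo zero    = 0
countFrom c lo (suc f) = bit (c lo) + countFrom c (suc lo) f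

count-+-countFrom : ∀ c lo f → count c lo + countFrom c lo f ≡ count c (lo + f)
count-+-countFrom c lo zero    = trans (+-identityʳ _) (cong (count c) (sym (+-identityʳ lo)))
count-+-countFrom c lo (suc f) = begin
  count c lo + (bit (c lo) + countFrom c (suc lo) f) ≡⟨ +-assoc (count c lo) _ _ ⟨
  count c (suc lo) + countFrom c (suc lo) f          ≡⟨ count-+-countFrom c (suc lo) f ⟩
  count c (suc lo + f)                               ≡⟨ cong (count c) (+-suc lo f) ⟨
  count c (lo + suc f)                               ∎
  where open ≡-Reasoning

enumerate : (c : ℕ → Bool) (lo f : ℕ) → Vec ℕ (countFrom c lo f)
enumerate c lo zero    = []
enumerate c lo (suc f) with c lo
... | true  = lo ∷ enumerate c (suc lo) f
... | false = enumerate c (suc lo) f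

enumerate-≥ : ∀ c lo f → All (lo ≤_) (enumerate c lo f)
enumerate-≥ c lo zero    = []
enumerate-≥ c lo (suc f) with c lo
... | true  = ≤-refl ∷ All.map <⇒≤ (enumerate-≥ c (suc lo) f)
... | false = All.map <⇒≤ (enumerate-≥ c (suc lo) f)

enumerate-increasing : ∀ c lo f → AllPairs _<_ (enumerate c lo f)
enumerate-increasing c lo zero    = []
enumerate-increasing c lo (suc f) with c lo
... | true  = enumerate-≥ c (suc lo) f ∷ enumerate-increasing c (suc lo) f
... | false = enumerate-increasing c (suc lo) f

occurs-enumerate : ∀ c lo f x → lo ≤ x → (c x ≡ true → x < lo + f) →
  occurs x (enumerate c lo f) ≡ c x
occurs-enumerate c lo zero x lo≤x bounded with c x in cx
... | true  = contradiction (bounded refl) (≤⇒≯ (subst (_≤ x) (sym (+-identityʳ lo)) lo≤x))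
... | false = refl
occurs-enumerate c lo (suc f) x lo≤x bounded with x ≟ lo
... | yes refl with c x
...   | true  rewrite ≡ᵇ-refl x = refl
...   | false = below⇒¬occurs (enumerate-≥ c (suc x) f)
occurs-enumerate c lo (suc f) x lo≤x bounded | no x≢lo =
  trans skip-lo (occurs-enumerate c (suc lo) f x (≤∧≢⇒< lo≤x (x≢lo ∘ sym))
                                                   (subst (x <_) (+-suc lo f) ∘ bounded))
  where
  skip-lo : occurs x (enumerate c lo (suc f)) ≡ occurs x (enumerate c (suc lo) f)
  skip-lo with c lo
  ... | true  = cong (_∨ occurs x (enumerate c (suc lo) f)) (≢⇒≡ᵇ-false x≢lo)
  ... | false = refl

fromPredicate : ∀ {n} (c : ℕ → Bool) M → count c M ≡ n → (∀ x → c x ≡ true → x < M) →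
  Σ (Vec ℕ n) λ v → AllPairs _<_ v × (∀ x → occurs x v ≡ c x)
fromPredicate c M count≡n bounded with trans (count-+-countFrom c 0 M) count≡n
... | refl =
  enumerate c 0 M , enumerate-increasing c 0 M , λ x → occurs-enumerate c 0 M x z≤n (bounded x)

-- On a block of consecutive points of a, count a grows at the maximal rate 1, so balance just
-- after the block gives balance throughout it.
balanced-off⇒balanced : ∀ (a c : ℕ → Bool) B → (∀ x → a x ≡ true → x < B) →
  (∀ x → a x ≡ false → count a x ≤ count c x) → ∀ x → count a x ≤ count c x
balanced-off⇒balanced a c B a<B balanced-off x = go (B ∸ x) x refl
  where
  go : ∀ d x → B ∸ x ≡ d → count a x ≤ count c x
  go d x eq with a x in ax
  ... | false = balanced-off x ax
  go zero    x eq | true = contradiction (a<B x ax) (≤⇒≯ (m∸n≡0⇒m≤n eq))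
  go (suc d) x eq | true = +-cancelʳ-≤ 1 _ _ (begin
    count a x + 1                 ≡⟨ cong (λ b → count a x + bit b) ax ⟨
    count a (suc x)               ≤⟨ go d (suc x) (trans (sym (pred[m∸n]≡m∸[1+n] B x)) (cong pred eq)) ⟩
    count c (suc x)               ≤⟨ +-monoʳ-≤ (count c x) (bit≤1 (c x)) ⟩
    count c x + 1                 ∎)
    where open ≤-Reasoning

-- Runs and the cyclic shift

module Rotation (a : ℕ → Bool) (N : ℕ) where

  prevA : ℕ → Bool
  prevA zero    = false
  prevA (suc y) = a y

  Run : ℕ → ℕ → Set
  Run s e = ∀ z → s ≤ z → z ≤ e → a z ≡ true

  Run-single : ∀ {x} → a x ≡ true → Run x x
  Run-single ax z x≤z z≤x = subst (λ y → a y ≡ true) (≤-antisym x≤z z≤x) ax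

  Run-snoc : ∀ {s e} → Run s e → a (suc e) ≡ true → Run s (suc e)
  Run-snoc run a1+e z s≤z z≤1+e with m≤n⇒m<n∨m≡n z≤1+e
  ... | inj₁ z<1+e = run z s≤z (≤-pred z<1+e)
  ... | inj₂ refl  = a1+e

  Run-cons : ∀ {s e} → a s ≡ true → Run (suc s) e → Run s e
  Run-cons as run z s≤z z≤e with m≤n⇒m<n∨m≡n s≤z
  ... | inj₁ s<z = run z s<z z≤e
  ... | inj₂ refl = as

  Run-init : ∀ {s e} → Run s (suc e) → Run s e
  Run-init run z s≤z z≤e = run z s≤z (m≤n⇒m≤1+n z≤e)

  maximalRun-unique : ∀ {s e e′} → s ≤ e → Run s e → a (suc e) ≡ false →
    s ≤ e′ → Run s e′ → a (suc e′) ≡ false → e ≡ e′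
  maximalRun-unique {s} {e} {e′} s≤e run ae s≤e′ run′ ae′ with <-cmp e e′
  ... | tri≈ _ e≡e′ _ = e≡e′
  ... | tri< e<e′ _ _ = contradiction ae  (≡true⇒≢false (run′ (suc e)  (m≤n⇒m≤1+n s≤e)  e<e′))
  ... | tri> _ _ e′<e = contradiction ae′ (≡true⇒≢false (run  (suc e′) (m≤n⇒m≤1+n s≤e′) e′<e))

  runStart : ℕ → ℕ
  runStart zero    = zero
  runStart (suc y) = if a y then runStart y else suc y

  runStart-fixed : ∀ x → prevA x ≡ false → runStart x ≡ x
  runStart-fixed zero    _   = refl
  runStart-fixed (suc y) ay rewrite ay = refl

  prevA-runStart : ∀ x → prevA (runStart x) ≡ false
  prevA-runStart zero = refl
  prevA-runStart (suc y) with a y in ay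
  ... | true  = prevA-runStart y
  ... | false = ay

  runStart-run : ∀ x → a x ≡ true → runStart x ≤ x × Run (runStart x) x
  runStart-run zero    a0 = ≤-refl , Run-single a0
  runStart-run (suc y) a1+y with a y in ay
  ... | true  = let s≤y , run = runStart-run y ay in m≤n⇒m≤1+n s≤y , Run-snoc run a1+y
  ... | false = ≤-refl , Run-single a1+y

  a-runStart : ∀ x → a x ≡ true → a (runStart x) ≡ true
  a-runStart x ax = let s≤x , run = runStart-run x ax in run (runStart x) ≤-refl s≤x

  runStart-unique : ∀ s e → prevA s ≡ false → s ≤ e → Run s e → runStart e ≡ s
  runStart-unique s e ps s≤e run with m≤n⇒m<n∨m≡n s≤e
  ... | inj₂ refl = runStart-fixed s ps
  runStart-unique s (suc e) ps s≤e run | inj₁ s<1+e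
    rewrite run e (≤-pred s<1+e) (n≤1+n e) = runStart-unique s e ps (≤-pred s<1+e) (Run-init run)

  runEndWithin : ℕ → ℕ → ℕ
  runEndWithin zero    y = y
  runEndWithin (suc f) y = if a (suc y) then runEndWithin f (suc y) else y

  -- Searching N steps suffices when a is bounded by N.
  runEnd : ℕ → ℕ
  runEnd = runEndWithin N

  -- On each maximal run s, …, e of a the values of c are shifted cyclically:
  -- rotate c takes the values c (s + 1), …, c e, c s there.
  rotate : (ℕ → Bool) → ℕ → Bool
  rotate c x = if a x then (if a (suc x) then c (suc x) else c (runStart x)) else c x

  unrotate : (ℕ → Bool) → ℕ → Bool
  unrotate c x = if a x then (if prevA x then c (pred x) else c (runEnd x)) else c x

  rotate-off : ∀ c x → a x ≡ false → rotate c x ≡ c x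
  rotate-off c x ax rewrite ax = refl

  rotate-inside : ∀ c x → a x ≡ true → a (suc x) ≡ true → rotate c x ≡ c (suc x)
  rotate-inside c x ax a1+x rewrite ax | a1+x = refl

  unrotate-off : ∀ c x → a x ≡ false → unrotate c x ≡ c x
  unrotate-off c x ax rewrite ax = refl

  rotate-cong : ∀ {c d} → (∀ y → c y ≡ d y) → ∀ x → rotate c x ≡ rotate d x
  rotate-cong c≗d x with a x | a (suc x)
  ... | true  | true  = c≗d (suc x)
  ... | true  | false = c≗d (runStart x)
  ... | false | _     = c≗d x

  unrotate-cong : ∀ {c d} → (∀ y → c y ≡ d y) → ∀ x → unrotate c x ≡ unrotate d x
  unrotate-cong c≗d x with a x | prevA x
  ... | true  | true  = c≗d (pred x)
  ... | true  | false = c≗d (runEnd x)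
  ... | false | _     = c≗d x

  insideRun : ℕ → Bool
  insideRun y = prevA y ∧ a y

  -- Below a point y inside a run, rotate c has traded the value c y for c (runStart y).
  count-rotate-defect : ∀ c y →
    bit (insideRun y ∧ c (runStart y)) + count (rotate c) y ≡ bit (insideRun y ∧ c y) + count c y
  count-rotate-defect c = sumBelow-telescope (bit ∘ rotate c) (bit ∘ c) traded kept step
    where
    traded kept : ℕ → ℕ
    traded y = bit (insideRun y ∧ c (runStart y))
    kept   y = bit (insideRun y ∧ c y)

    step : ∀ i → traded (suc i) + (kept i + bit (rotate c i)) ≡ traded i + (kept (suc i) + bit (c i))
    step i with a i | a (suc i) | prevA i in pi
    ... | false | _     | true  = refl
    ... | false | _     | false = refl
    ... | true  | true  | true  = cong (bit (c (runStart i)) +_) (+-comm (bit (c i)) _)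
    ... | true  | true  | false rewrite runStart-fixed i pi = +-comm (bit (c i)) _
    ... | true  | false | true  = +-comm (bit (c i)) _
    ... | true  | false | false rewrite runStart-fixed i pi = refl

  count-rotate : ∀ c y → a y ≡ false → count (rotate c) y ≡ count c y
  count-rotate c y ay with prevA y | count-rotate-defect c y
  ... | true  | defect rewrite ay = defect
  ... | false | defect = defect

  module _ (a≤N : ∀ x → a x ≡ true → x ≤ N) where

    beyond-N : ∀ x → N < x → a x ≡ false
    beyond-N x N<x with a x in ax
    ... | true  = contradiction (a≤N x ax) (<⇒≱ N<x)
    ... | false = refl

    runEnd-spec : ∀ x → a x ≡ true →
      x ≤ runEnd x × Run x (runEnd x) × a (suc (runEnd x)) ≡ false
    runEnd-spec x = go N x (m≤n+m N x)
      where
      go : ∀ f y → N ≤ y + f → a y ≡ true →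
        y ≤ runEndWithin f y × Run y (runEndWithin f y) × a (suc (runEndWithin f y)) ≡ false
      go zero    y N≤y ay =
        ≤-refl , Run-single ay , beyond-N (suc y) (s≤s (subst (N ≤_) (+-identityʳ y) N≤y))
      go (suc f) y N≤y+f ay with a (suc y) in a1+y
      ... | false = ≤-refl , Run-single ay , a1+y
      ... | true  =
        let 1+y≤e , run , ae = go f (suc y) (subst (N ≤_) (+-suc y f) N≤y+f) a1+y
        in <⇒≤ 1+y≤e , Run-cons ay run , ae

    runEnd-unique : ∀ x e → x ≤ e → Run x e → a (suc e) ≡ false → runEnd x ≡ e
    runEnd-unique x e x≤e run ae =
      let x≤r , run′ , ar = runEnd-spec x (run x ≤-refl x≤e)
      in maximalRun-unique x≤r run′ ar x≤e run ae

    rotate-unrotate : ∀ c x → rotate (unrotate c) x ≡ c x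
    rotate-unrotate c x with a x in ax
    ... | false = refl
    ... | true with a (suc x) in a1+x
    ...   | true  = refl
    ...   | false rewrite a-runStart x ax | prevA-runStart x =
      let s≤x , run = runStart-run x ax in cong c (runEnd-unique (runStart x) x s≤x run a1+x)

    unrotate-rotate : ∀ c x → unrotate (rotate c) x ≡ c x
    unrotate-rotate c x with a x in ax
    ... | false = refl
    ... | true with prevA x in px
    unrotate-rotate c (suc y) | true | true rewrite px | ax = refl
    unrotate-rotate c x       | true | false
      with runEnd x | runEnd-spec x ax
    ... | e | x≤e , run , ae rewrite run e x≤e ≤-refl | ae = cong c (runStart-unique x e px x≤e run)

    count-unrotate : ∀ c y → a y ≡ false → count (unrotate c) y ≡ count c y
    count-unrotate c y ay = trans (sym (count-rotate (unrotate c) y ay)) (count-cong (rotate-unrotate c) y)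

-- Tableaux in RInc_k(2 × n)

module Tableau {k n : ℕ} (T : RInc k n) where
  open IsRInc (proj₂ T)

  N : ℕ
  N = 2 * n ∸ k

  v w : Vec ℕ n
  v = row₁ (array T)
  w = row₂ (array T)

  inRow₁ inRow₂ : ℕ → Bool
  inRow₁ = occursIn v
  inRow₂ = occursIn w

  row₁-increasing : AllPairs _<_ v
  row₁-increasing = Increasing⇒AllPairs v row₁-strict

  row₂-increasing : AllPairs _<_ w
  row₂-increasing = Increasing⇒AllPairs w row₂-strict

  inRow₁-bounded : ∀ x → inRow₁ x ≡ true → 1 ≤ x × x ≤ N
  inRow₁-bounded x x∈ = Equivalence.to (entries x) (inj₁ (occurs⇒∈ᵣ x v x∈))

  inRow₂-bounded : ∀ x → inRow₂ x ≡ true → 1 ≤ x × x ≤ N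
  inRow₂-bounded x x∈ = Equivalence.to (entries x) (inj₂ (occurs⇒∈ᵣ x w x∈))

  inRow₂⇒1≤ : ∀ x → inRow₂ x ≡ true → 1 ≤ x
  inRow₂⇒1≤ x = proj₁ ∘ inRow₂-bounded x

  inRow₂⇒≤N : ∀ x → inRow₂ x ≡ true → x ≤ N
  inRow₂⇒≤N x = proj₂ ∘ inRow₂-bounded x

  inRow₂-beyond : ∀ x → N < x → inRow₂ x ≡ false
  inRow₂-beyond x N<x with inRow₂ x in x∈
  ... | true  = contradiction (proj₂ (inRow₂-bounded x x∈)) (<⇒≱ N<x)
  ... | false = refl

  inRow₁-beyond : ∀ x → N < x → inRow₁ x ≡ false
  inRow₁-beyond x N<x with inRow₁ x in x∈
  ... | true  = contradiction (proj₂ (inRow₁-bounded x x∈)) (<⇒≱ N<x)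
  ... | false = refl

  inRow₁-complement : ∀ x → 1 ≤ x → x ≤ N → inRow₂ x ≡ false → inRow₁ x ≡ true
  inRow₁-complement x 1≤x x≤N x∉ with Equivalence.from (entries x) (1≤x , x≤N)
  ... | inj₁ x∈₁ = ∈ᵣ⇒occurs v x∈₁
  ... | inj₂ x∈₂ = contradiction x∉ (≡true⇒≢false (∈ᵣ⇒occurs w x∈₂))

  count-inRow₁ : ∀ m → N < m → count inRow₁ m ≡ n
  count-inRow₁ m N<m = count-occursIn-all row₁-increasing
    (lookup⁻ λ j → ≤-<-trans (proj₂ (inRow₁-bounded _ (occurs-lookup v j))) N<m)

  count-inRow₂ : ∀ m → N < m → count inRow₂ m ≡ n
  count-inRow₂ m N<m = count-occursIn-all row₂-increasing
    (lookup⁻ λ j → ≤-<-trans (proj₂ (inRow₂-bounded _ (occurs-lookup w j))) N<m)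

  balanced : ∀ m → count inRow₂ m ≤ count inRow₁ m
  balanced = columnwise⇒balanced row₁-increasing row₂-increasing col-weak

  N-inRow₂ : 1 ≤ N → inRow₂ N ≡ true
  N-inRow₂ 1≤N with Equivalence.from (entries N) (1≤N , ≤-refl)
  ... | inj₂ N∈₂         = ∈ᵣ⇒occurs w N∈₂
  ... | inj₁ (j , T₁ⱼ≡N) = subst (λ x → inRow₂ x ≡ true) T₂ⱼ≡N (occurs-lookup w j)
    where
    T₂ⱼ≡N : lookup w j ≡ N
    T₂ⱼ≡N = ≤-antisym (inRow₂⇒≤N _ (occurs-lookup w j)) (subst (_≤ lookup w j) T₁ⱼ≡N (col-weak j))

  module WithRow₁ (c′ : ℕ → Bool)
    (agrees-off : ∀ x → inRow₂ x ≡ false → c′ x ≡ inRow₁ x)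
    (counts-off : ∀ x → inRow₂ x ≡ false → count c′ x ≡ count inRow₁ x) where

    c′-bounded : ∀ x → c′ x ≡ true → 1 ≤ x × x ≤ N
    c′-bounded x c′x with inRow₂ x in x∈₂
    ... | true  = inRow₂-bounded x x∈₂
    ... | false = inRow₁-bounded x (trans (sym (agrees-off x x∈₂)) c′x)

    count-c′ : count c′ (suc N) ≡ n
    count-c′ =
      trans (counts-off (suc N) (inRow₂-beyond (suc N) ≤-refl)) (count-inRow₁ (suc N) ≤-refl)

    v′-construction : Σ (Vec ℕ n) λ v′ → AllPairs _<_ v′ × (∀ x → occurs x v′ ≡ c′ x)
    v′-construction = fromPredicate c′ (suc N) count-c′ (λ x c′x → s≤s (proj₂ (c′-bounded x c′x)))

    v′ : Vec ℕ n
    v′ = proj₁ v′-construction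

    v′-increasing : AllPairs _<_ v′
    v′-increasing = proj₁ (proj₂ v′-construction)

    occurs-v′ : ∀ x → occurs x v′ ≡ c′ x
    occurs-v′ = proj₂ (proj₂ v′-construction)

    balanced′ : ∀ m → count inRow₂ m ≤ count (occursIn v′) m
    balanced′ m = subst (count inRow₂ m ≤_) (count-cong (sym ∘ occurs-v′) m)
      (balanced-off⇒balanced inRow₂ c′ (suc N) (λ x → s≤s ∘ inRow₂⇒≤N x)
        (λ x x∉₂ → subst (count inRow₂ x ≤_) (sym (counts-off x x∉₂)) (balanced x)) m)

    entries′ : ∀ x → ((x ∈ᵣ v′) ⊎ (x ∈ᵣ w)) ⇔ (1 ≤ x × x ≤ N)
    entries′ x = mk⇔ to from
      where
      to : (x ∈ᵣ v′) ⊎ (x ∈ᵣ w) → 1 ≤ x × x ≤ N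
      to (inj₁ x∈v′) = c′-bounded x (trans (sym (occurs-v′ x)) (∈ᵣ⇒occurs v′ x∈v′))
      to (inj₂ x∈w)  = inRow₂-bounded x (∈ᵣ⇒occurs w x∈w)
      from : 1 ≤ x × x ≤ N → (x ∈ᵣ v′) ⊎ (x ∈ᵣ w)
      from (1≤x , x≤N) with inRow₂ x in x∈₂
      ... | true  = inj₂ (occurs⇒∈ᵣ x w x∈₂)
      ... | false = inj₁ (occurs⇒∈ᵣ x v′
        (trans (occurs-v′ x) (trans (agrees-off x x∈₂) (inRow₁-complement x 1≤x x≤N x∈₂))))

    tableau : RInc k n
    tableau = (v′ , w) , record
      { row₁-strict = AllPairs⇒Increasing v′-increasing
      ; row₂-strict = row₂-strict
      ; col-weak    = balanced⇒columnwise v′-increasing row₂-increasing balanced′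
      ; entries     = entries′
      }

  N≡n+[n∸k] : k ≤ n → N ≡ n + (n ∸ k)
  N≡n+[n∸k] k≤n = trans (cong (λ m → n + m ∸ k) (+-identityʳ n)) (+-∸-assoc n k≤n)

  N-positive : 1 ≤ n → k ≤ n → 1 ≤ N
  N-positive 1≤n k≤n = ≤-trans 1≤n (subst (n ≤_) (sym (N≡n+[n∸k] k≤n)) (m≤m+n n (n ∸ k)))

  -- The potential pred i on row-2 entries i turns the per-run count into a local identity;
  -- lastEntry pays back the ascent that the run ending at N lacks.
  module ShiftedRow₁ (1≤N : 1 ≤ N) (v′ : Vec ℕ n)
    (agrees-off : ∀ x → inRow₂ x ≡ false → occurs x v′ ≡ inRow₁ x)
    (shifted-on : ∀ x → inRow₂ x ≡ true → inRow₂ (suc x) ≡ true → occurs x v′ ≡ inRow₁ (suc x))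
    where

    descent ascent potential lastEntry : ℕ → ℕ
    descent   i = if occurs i v′ ∧ inRow₂ (suc i) then i else 0
    ascent    i = if inRow₂ i ∧ inRow₁ (suc i) then i else 0
    potential i = if inRow₂ i then pred i else 0
    lastEntry i = if i ≡ᵇ N then N else 0

    off-row₂⇒≢N : ∀ {i} → inRow₂ i ≡ false → ¬ i ≡ N
    off-row₂⇒≢N i∉₂ refl = ≡true⇒≢false (N-inRow₂ 1≤N) i∉₂

    pred+1 : ∀ {i} → 1 ≤ i → pred i + 1 ≡ i
    pred+1 {suc j} _ = +-comm j 1

    entering : ∀ i → inRow₂ i ≡ false → inRow₂ (suc i) ≡ true → (if inRow₁ i then i else 0) ≡ i
    entering zero    _ _ with inRow₁ 0
    ... | true  = refl
    ... | false = refl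
    entering (suc j) i∉₂ 2+j∈₂
      rewrite inRow₁-complement (suc j) (s≤s z≤n) (<⇒≤ (inRow₂⇒≤N _ 2+j∈₂)) i∉₂ = refl

    potential-step : ∀ i →
      potential i + (descent i + bit (inRow₂ i)) ≡ potential (suc i) + (ascent i + lastEntry i)
    potential-step i with inRow₂ i in i∈₂ | inRow₂ (suc i) in 1+i∈₂
    ... | false | false rewrite ∧-zeroʳ (occurs i v′) | ≢⇒≡ᵇ-false (off-row₂⇒≢N i∈₂) = refl
    ... | false | true
      rewrite ∧-identityʳ (occurs i v′) | agrees-off i i∈₂ | ≢⇒≡ᵇ-false (off-row₂⇒≢N i∈₂) =
      cong (_+ 0) (entering i i∈₂ 1+i∈₂)
    ... | true  | true
      rewrite ∧-identityʳ (occurs i v′) | shifted-on i i∈₂ 1+i∈₂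
            | ≢⇒≡ᵇ-false (<⇒≢ (inRow₂⇒≤N (suc i) 1+i∈₂)) =
      trans (regroup (pred i) _) (cong (_+ (ascentᵢ + 0)) (pred+1 (inRow₂⇒1≤ i i∈₂)))
      where
      ascentᵢ = if inRow₁ (suc i) then i else 0
      regroup : ∀ p x → p + (x + 1) ≡ p + 1 + (x + 0)
      regroup = solve-∀
    ... | true  | false rewrite ∧-zeroʳ (occurs i v′) with i ≟ N
    ...   | yes refl rewrite ≡ᵇ-refl N | inRow₁-beyond (suc N) ≤-refl = pred+1 1≤N
    ...   | no  i≢N
      rewrite ≢⇒≡ᵇ-false i≢N
            | inRow₁-complement (suc i) (s≤s z≤n) (≤∧≢⇒< (inRow₂⇒≤N i i∈₂) i≢N) 1+i∈₂ =
      trans (pred+1 (inRow₂⇒1≤ i i∈₂)) (sym (+-identityʳ i))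

    maj+n : maj (v′ , w) + n ≡ amaj (array T) + N
    maj+n = begin
      maj (v′ , w) + n
        ≡⟨ cong₂ _+_ (sum-map-upTo descent M) (sym (count-inRow₂ M N<M)) ⟩
      sumBelow descent M + count inRow₂ M
        ≡⟨ sumBelow-+ descent (bit ∘ inRow₂) M ⟨
      sumBelow (λ i → descent i + bit (inRow₂ i)) M
        ≡⟨ cong (_+ sumBelow (λ i → descent i + bit (inRow₂ i)) M) potential-0 ⟨
      potential 0 + sumBelow (λ i → descent i + bit (inRow₂ i)) M
        ≡⟨ sumBelow-telescope _ _ (λ _ → 0) potential potential-step M ⟩
      potential M + sumBelow (λ i → ascent i + lastEntry i) M
        ≡⟨ cong₂ _+_ potential-M (sumBelow-+ ascent lastEntry M) ⟩
      sumBelow ascent M + sumBelow lastEntry M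
        ≡⟨ cong₂ _+_ (sym (sum-map-upTo ascent M)) (sumBelow-single N N M N<M) ⟩
      amaj (array T) + N ∎
      where
      open ≡-Reasoning
      M = suc (2 * n)

      N<M : N < M
      N<M = s≤s (m∸n≤m (2 * n) k)

      potential-0 : potential 0 ≡ 0
      potential-0 with inRow₂ 0
      ... | true  = refl
      ... | false = refl

      potential-M : potential M ≡ 0
      potential-M rewrite inRow₂-beyond M N<M = refl

module RowRotation {k n : ℕ} (T : RInc k n) where
  open Tableau T public
  open Rotation inRow₂ N public

  module Rotated   = WithRow₁ (rotate inRow₁) (rotate-off inRow₁) (count-rotate inRow₁)
  module Unrotated =
    WithRow₁ (unrotate inRow₁) (unrotate-off inRow₁) (count-unrotate inRow₂⇒≤N inRow₁)

rotateRow₁ unrotateRow₁ : ∀ {k n} → RInc k n → RInc k n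
rotateRow₁   T = RowRotation.Rotated.tableau T
unrotateRow₁ T = RowRotation.Unrotated.tableau T

rotateRow₁-row₂ : ∀ {k n} (T : RInc k n) → row₂ (array (rotateRow₁ T)) ≡ row₂ (array T)
rotateRow₁-row₂ T = refl

rotateRow₁-maj : ∀ {k n} → 1 ≤ n → k ≤ n → (T : RInc k n) →
  maj (array (rotateRow₁ T)) ≡ amaj (array T) + (n ∸ k)
rotateRow₁-maj {k} {n} 1≤n k≤n T = +-cancelʳ-≡ n _ _ (begin
  maj (array (rotateRow₁ T)) + n  ≡⟨ ShiftedRow₁.maj+n (N-positive 1≤n k≤n) v′ agrees-off shifted-on ⟩
  amaj (array T) + N              ≡⟨ cong (amaj (array T) +_) (N≡n+[n∸k] k≤n) ⟩
  amaj (array T) + (n + (n ∸ k))  ≡⟨ cong (amaj (array T) +_) (+-comm n (n ∸ k)) ⟩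
  amaj (array T) + ((n ∸ k) + n)  ≡⟨ +-assoc (amaj (array T)) (n ∸ k) n ⟨
  amaj (array T) + (n ∸ k) + n    ∎)
  where
  open RowRotation T
  open Rotated using (v′; occurs-v′)
  open ≡-Reasoning

  agrees-off : ∀ x → inRow₂ x ≡ false → occurs x v′ ≡ inRow₁ x
  agrees-off x x∉₂ = trans (occurs-v′ x) (rotate-off inRow₁ x x∉₂)

  shifted-on : ∀ x → inRow₂ x ≡ true → inRow₂ (suc x) ≡ true → occurs x v′ ≡ inRow₁ (suc x)
  shifted-on x x∈₂ 1+x∈₂ = trans (occurs-v′ x) (rotate-inside inRow₁ x x∈₂ 1+x∈₂)

rotateRow₁-injective : ∀ {k n} (T T′ : RInc k n) →
  array (rotateRow₁ T) ≡ array (rotateRow₁ T′) → array T ≡ array T′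
rotateRow₁-injective T@((v , w) , _) T′@((v′ , w′) , _) eq with cong proj₂ eq
... | refl = cong (_, w) (occursIn-injective R.row₁-increasing R′.row₁-increasing same-row₁)
  where
  module R  = RowRotation T
  module R′ = RowRotation T′

  same-rotation : ∀ y → R.rotate R.inRow₁ y ≡ R.rotate R′.inRow₁ y
  same-rotation y = begin
    R.rotate R.inRow₁ y  ≡⟨ R.Rotated.occurs-v′ y ⟨
    occurs y (row₁ (array (rotateRow₁ T)))  ≡⟨ cong (occurs y ∘ proj₁) eq ⟩
    occurs y (row₁ (array (rotateRow₁ T′))) ≡⟨ R′.Rotated.occurs-v′ y ⟩
    R.rotate R′.inRow₁ y ∎
    where open ≡-Reasoning

  same-row₁ : ∀ x → occurs x v ≡ occurs x v′
  same-row₁ x = begin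
    occurs x v                         ≡⟨ R.unrotate-rotate R.inRow₂⇒≤N R.inRow₁ x ⟨
    R.unrotate (R.rotate R.inRow₁) x   ≡⟨ R.unrotate-cong same-rotation x ⟩
    R.unrotate (R.rotate R′.inRow₁) x  ≡⟨ R′.unrotate-rotate R′.inRow₂⇒≤N R′.inRow₁ x ⟩
    occurs x v′                        ∎
    where open ≡-Reasoning

rotateRow₁-surjective : ∀ {k n} (S : RInc k n) → ∃ λ T → array (rotateRow₁ T) ≡ array S
rotateRow₁-surjective S =
  unrotateRow₁ S , cong (_, w) (occursIn-injective U.Rotated.v′-increasing row₁-increasing same-row₁)
  where
  open RowRotation S
  module U = RowRotation (unrotateRow₁ S)

  same-row₁ : ∀ x → occurs x U.Rotated.v′ ≡ inRow₁ x
  same-row₁ x = begin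
    occurs x U.Rotated.v′        ≡⟨ U.Rotated.occurs-v′ x ⟩
    rotate U.inRow₁ x            ≡⟨ rotate-cong Unrotated.occurs-v′ x ⟩
    rotate (unrotate inRow₁) x   ≡⟨ rotate-unrotate inRow₂⇒≤N inRow₁ x ⟩
    inRow₁ x                     ∎
    where open ≡-Reasoning

theorem3p4 : ∀ (n k : ℕ) → 1 ≤ n → k ≤ n →
    Σ (RInc k n → RInc k n) λ Φ →
      (∀ (T T′ : RInc k n) → array (Φ T) ≡ array (Φ T′) → array T ≡ array T′)
      × (∀ (S : RInc k n) → ∃ λ T → array (Φ T) ≡ array S)
      × (∀ T → row₂ (array (Φ T)) ≡ row₂ (array T))
      × (∀ T → maj (array (Φ T)) ≡ amaj (array T) + (n ∸ k))
theorem3p4 n k 1≤n k≤n =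
  rotateRow₁ , rotateRow₁-injective , rotateRow₁-surjective , rotateRow₁-row₂ , rotateRow₁-maj 1≤n k≤n
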